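{- Run Algorithm 1 (described in the context) with step size $\delta$ on a nonnegative submodular $f:2^X\to\mathbb{R}_+$, $n=|X|$, $OPT=\max_{S\subseteq X}f(S)$. For each value $p$ of the parameter, let $A(p)$ be the local optimum obtained after the local search phase for $p$, and $\Phi(p)=F(\mathbf{x}_p(A(p)))$. Assume that $f(X\setminus A(p))\le\beta$ for all $p$. Then for every $p$ for which $p+\delta$ is also a parameter value, $$\frac{1-p}{\delta}\big(\Phi(p+\delta)-\Phi(p)\big)\ge(1-2\delta n^2)\,OPT-2\Phi(p)-(2p-1)\beta.$$
   Context: Submodular: $f(S\cup T)+f(S\cap T)\le f(S)+f(T)$. $F(\mathbf{x})=\sum_{S\subseteq X}f(S)\prod_{i\in S}x_i\prod_{j\notin S}(1-x_j)$. $\mathbf{x}_p(A)=p\mathbf{1}_A+(1-p)\mathbf{1}_{X\setminus A}$. Algorithm 1: start with $A=\emptyset$; for $p=\tfrac12,\tfrac12+\delta,\tfrac12+2\delta,\dots$ with $p<1$: while some $i\in X$ satisfies $F(\mathbf{x}_p(A\triangle\{i\}))>F(\mathbf{x}_p(A))$, replace $A$ by $A\triangle\{i\}$ (local search phase; it ends at a set $A$ with $F(\mathbf{x}_p(A\triangle\{i\}))\le F(\mathbf{x}_p(A))$ for all $i$), then pass to the next $p$ keeping the current $A$.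
   Formalization: The submodular function f takes rational rather than real values, and the step size δ and the bound β are rational numbers. -}

module Defs where

open import Data.Nat as ℕ using (ℕ; zero; suc)
open import Data.Integer using (+_)
open import Data.Fin using (Fin; zero; suc)
open import Data.Bool using (Bool; true; false; not; if_then_else_)
open import Data.Fin.Subset using (Subset; _∪_; _∩_; ⊥; inside; outside)
open import Data.Vec using (Vec; []; _∷_; lookup; updateAt)
open import Data.List using (List; []; _∷_; map; _++_; foldr)
open import Data.Rational using (ℚ; _+_; _*_; _-_; _≤_; _<_; _/_; 0ℚ; 1ℚ; ½)
open import Data.Product using (Σ; ∃; _×_)
open import Function using (_∘_)
open import Relation.Binary.PropositionalEquality using (_≡_)
open import Relation.Binary.Construct.Closure.ReflexiveTransitive using (Star)

private variable n : ℕ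

-- Ground set X = Fin n; subsets of X are Data.Fin.Subset n (= Vec Bool n).

allSubsets : (n : ℕ) → List (Subset n)
allSubsets zero    = [] ∷ []
allSubsets (suc n) = map (outside ∷_) (allSubsets n) ++ map (inside ∷_) (allSubsets n)

weight : Subset n → (Fin n → ℚ) → ℚ
weight []          x = 1ℚ
weight (true ∷ S)  x = x zero * weight S (x ∘ suc)
weight (false ∷ S) x = (1ℚ - x zero) * weight S (x ∘ suc)

F : (Subset n → ℚ) → (Fin n → ℚ) → ℚ
F {n} f x = foldr (λ S acc → f S * weight S x + acc) 0ℚ (allSubsets n)

xp : ℚ → Subset n → (Fin n → ℚ)
xp p A i = if lookup A i then p else (1ℚ - p)

flipAt : Subset n → Fin n → Subset n
flipAt A i = updateAt A i not

Nonnegative : (Subset n → ℚ) → Set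
Nonnegative f = ∀ S → 0ℚ ≤ f S

Submodular : (Subset n → ℚ) → Set
Submodular f = ∀ S T → f (S ∪ T) + f (S ∩ T) ≤ f S + f T

IsMax : (Subset n → ℚ) → ℚ → Set
IsMax f OPT = (∃ λ S → f S ≡ OPT) × (∀ S → f S ≤ OPT)

Improves : (Subset n → ℚ) → ℚ → Subset n → Subset n → Set
Improves f p A B = ∃ λ i → (B ≡ flipAt A i) × (F f (xp p A) < F f (xp p B))

LocalOpt : (Subset n → ℚ) → ℚ → Subset n → Set
LocalOpt f p A = ∀ i → F f (xp p (flipAt A i)) ≤ F f (xp p A)

LocalSearchPhase : (Subset n → ℚ) → ℚ → Subset n → Subset n → Set
LocalSearchPhase f p A B = Star (Improves f p) A B × LocalOpt f p B

param : ℚ → ℕ → ℚ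
param δ j = ½ + ((+ j / 1) * δ)

startSet : (ℕ → Subset n) → ℕ → Subset n
startSet A zero    = ⊥
startSet A (suc j) = A j

-- A j = A(p_j) describes a run of Algorithm 1 with step δ (for all j with p_j < 1)
IsRun : (Subset n → ℚ) → ℚ → (ℕ → Subset n) → Set
IsRun f δ A = ∀ j → param δ j < 1ℚ → LocalSearchPhase f (param δ j) (startSet A j) (A j)

module Submission where

-- The multilinear extension is computed coordinate by coordinate,
-- ML f x = (1-x₀) ML f(0∷·) + x₀ ML f(1∷·) (and F = ML), so that all its
-- properties are inductions on n: positivity, bounds, partial derivatives
-- ∂ᵢ, the exact effect of changing one coordinate, and the Taylor bound
--   |ML f y - ML f x - ⟨y - x, ∇ML f x⟩| ≤ 2n(n-1) δ² max|f|   (|y - x| ≤ δ).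
-- Submodularity (diminishing returns) gives two inequalities, proved by the
-- same induction: ⟨1_C - x, ∇ML f x⟩ ≥ ML f(x ∨ 1_C) + ML f(x ∧ 1_C) - 2 ML f x,
-- and ML h(x_p(A)) ≥ (1-p)(h X + h ∅) + (2p-1) h A for p ≥ ½.  At a local
-- optimum A of a phase p > ½ every sgn_A(i) ∂ᵢ is ≥ 0; with the two
-- inequalities this yields the key inequality
--   (1-p) ⟨sgn_A, ∇ML f x⟩ ≥ OPT - 2 ML f x - (2p-1) f(X ∖ A),  x = x_p(A).
-- For p > ½ the lemma follows from x_{p+δ}(A) - x_p(A) = δ sgn_A, the Taylor
-- bound, the key inequality and the fact that local search only increases
-- ML f.  For p = ½ the point x_½(A) is the centre of the cube; there the key
-- inequality is used at ½ + δ and the Taylor bound backwards from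
-- x_{½+δ}(A(½+δ)) to the centre.

open import Defs
open import Data.Nat using (ℕ; suc)
open import Data.Integer using (+_)
open import Data.Fin.Subset using (Subset; ∁)
open import Data.Rational using (ℚ; _+_; _*_; _-_; _≤_; _<_; _/_; 0ℚ; 1ℚ)

open import Algebra.Bundles using (CommutativeRing; CommutativeMonoid)
import Algebra.Properties.CommutativeSemigroup as CommSemigroupProperties
open import Data.Bool using (Bool; true; false; not; if_then_else_)
open import Data.Fin using (Fin; zero; suc)
open import Data.Fin.Subset using (_∪_; _∩_; ⊤; ⊥; inside; outside)
import Data.Fin.Subset.Properties as SubsetP
import Data.Integer as ℤ
import Data.Integer.Properties as ℤP
open import Data.List using (List; []; _∷_; map; _++_; foldr)
open import Data.Nat using (zero)
import Data.Nat.Coprimality as Coprimality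
import Data.Nat.Properties as ℕP
open import Data.Fin.Properties using (suc-injective)
open import Data.Product using (_×_; _,_; proj₁; proj₂)
import Data.Rational as ℚ
open import Data.Rational using (-_; ½; mkℚ)
import Data.Rational.Properties as ℚP
open import Data.Rational.Solver using (module +-*-Solver)
open import Data.Vec using ([]; _∷_; lookup)
import Data.Vec.Properties as VecP
open import Data.Vec.Functional using (tail)
open import Function using (_∘_)
open import Relation.Binary.Construct.Closure.ReflexiveTransitive using (Star; ε; _◅_)
open import Relation.Binary.PropositionalEquality
open import Relation.Nullary using (¬_)

open import Algebra.Properties.Semiring.Sum (CommutativeRing.semiring ℚP.+-*-commutativeRing)
  using (sum; sum-cong-≗; ∑-distrib-+; *-distribˡ-sum)
open +-*-Solver
open ≡-Reasoning

private variable
  n : ℕ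

-- Inequalities on ℚ in certificate form: to show a ≤ b we exhibit b - a as
-- a sum of products of nonnegative quantities (the equation is checked by
-- the ring solver).

0≤+ : ∀ {a b} → 0ℚ ≤ a → 0ℚ ≤ b → 0ℚ ≤ a + b
0≤+ = ℚP.+-mono-≤

0≤* : ∀ {a b} → 0ℚ ≤ a → 0ℚ ≤ b → 0ℚ ≤ a * b
0≤* {a} {b} ha hb =
  ℚP.nonNegative⁻¹ (a * b) {{ℚP.nonNeg*nonNeg⇒nonNeg a {{ℚ.nonNegative ha}} b {{ℚ.nonNegative hb}}}}

≤⇒0≤- : ∀ {a b} → a ≤ b → 0ℚ ≤ b - a
≤⇒0≤- {a} a≤b = ℚP.≤-trans (ℚP.≤-reflexive (sym (ℚP.+-inverseʳ a))) (ℚP.+-monoˡ-≤ (- a) a≤b)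

0≤-⇒≤ : ∀ {b a} → 0ℚ ≤ b - a → a ≤ b
0≤-⇒≤ {b} {a} h =
  subst₂ _≤_ (ℚP.+-identityˡ a) (solve 2 (λ a b → (b :- a) :+ a := b) refl a b) (ℚP.+-monoˡ-≤ a h)

<⇒0<- : ∀ {a b} → a < b → 0ℚ < b - a
<⇒0<- {a} a<b = ℚP.<-respˡ-≡ (ℚP.+-inverseʳ a) (ℚP.+-monoˡ-< (- a) a<b)

0<-⇒< : ∀ {b a} → 0ℚ < b - a → a < b
0<-⇒< {b} {a} h =
  subst₂ _<_ (ℚP.+-identityˡ a) (solve 2 (λ a b → (b :- a) :+ a := b) refl a b) (ℚP.+-monoˡ-< a h)

0≤+0< : ∀ {a b} → 0ℚ ≤ a → 0ℚ < b → 0ℚ < a + b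
0≤+0< = ℚP.+-mono-≤-<

0≤½ : 0ℚ ≤ ½
0≤½ = ℚP.≤ᵇ⇒≤ _

0≤-cancelˡ : ∀ {c d} → 0ℚ < c → 0ℚ ≤ c * d → 0ℚ ≤ d
0≤-cancelˡ {c} c>0 h =
  ℚP.*-cancelˡ-≤-pos c {{ℚ.positive c>0}} (ℚP.≤-trans (ℚP.≤-reflexive (ℚP.*-zeroʳ c)) h)

fromℕ : ℕ → ℚ
fromℕ k = + k / 1

fromℕ-suc : ∀ k → fromℕ (suc k) ≡ fromℕ k + 1ℚ
fromℕ-suc k = begin
  + suc k / 1         ≡⟨ ℚP./-cong {+ suc k} {1} {+ k ℤ.* + 1 ℤ.+ + 1 ℤ.* + 1} {1} numerator refl ⟩
  mkℚ (+ k) 0 k⊥1 + 1ℚ  ≡⟨ cong (_+ 1ℚ) (sym (ℚP.normalize-coprime k⊥1)) ⟩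
  + k / 1 + 1ℚ        ∎
  where
  k⊥1 : Coprimality.Coprime k 1
  k⊥1 = Coprimality.sym (Coprimality.1-coprimeTo k)
  numerator : + suc k ≡ + k ℤ.* + 1 ℤ.+ + 1 ℤ.* + 1
  numerator = sym (trans (cong (ℤ._+ + 1) (ℤP.*-identityʳ (+ k))) (cong +_ (ℕP.+-comm k 1)))

fromℕ-nonneg : ∀ k → 0ℚ ≤ fromℕ k
fromℕ-nonneg zero    = ℚP.≤-refl
fromℕ-nonneg (suc k) = subst (0ℚ ≤_) (sym (fromℕ-suc k)) (0≤+ (fromℕ-nonneg k) (ℚP.≤ᵇ⇒≤ _))

record InUnit (u : ℚ) : Set where
  constructor unit
  field
    ≥0 : 0ℚ ≤ u
    ≤1 : 0ℚ ≤ 1ℚ - u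

mix : ℚ → ℚ → ℚ → ℚ
mix u a b = (1ℚ - u) * a + u * b

:mix : ∀ {m} → Polynomial m → Polynomial m → Polynomial m → Polynomial m
:mix u a b = (con 1ℚ :- u) :* a :+ u :* b

mix-sub : ∀ u a b c d → mix u (a - b) (c - d) ≡ mix u a c - mix u b d
mix-sub = solve 5 (λ u a b c d → :mix u (a :- b) (c :- d) := :mix u a c :- :mix u b d) refl

mix-scale : ∀ u t a b → mix u (t * a) (t * b) ≡ t * mix u a b
mix-scale = solve 4 (λ u t a b → :mix u (t :* a) (t :* b) := t :* :mix u a b) refl

mix-nonneg : ∀ {u a b} → InUnit u → 0ℚ ≤ a → 0ℚ ≤ b → 0ℚ ≤ mix u a b
mix-nonneg (unit u≥0 1-u≥0) ha hb = 0≤+ (0≤* 1-u≥0 ha) (0≤* u≥0 hb)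

record Bounded (M a : ℚ) : Set where
  constructor bounds
  field
    upper : 0ℚ ≤ M - a
    lower : 0ℚ ≤ M + a

Bounded-resp : ∀ {M N a} → M ≡ N → Bounded M a → Bounded N a
Bounded-resp refl h = h

Bounded-mix : ∀ {u M a b} → InUnit u → Bounded M a → Bounded M b → Bounded M (mix u a b)
Bounded-mix {u} {M} {a} {b} u∈I (bounds a≤ a≥) (bounds b≤ b≥) = bounds
  (subst (0ℚ ≤_) (solve 4 (λ u M a b → (con 1ℚ :- u) :* (M :- a) :+ u :* (M :- b)
                                      := M :- ((con 1ℚ :- u) :* a :+ u :* b)) refl u M a b)
         (mix-nonneg u∈I a≤ b≤))
  (subst (0ℚ ≤_) (solve 4 (λ u M a b → (con 1ℚ :- u) :* (M :+ a) :+ u :* (M :+ b)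
                                      := M :+ ((con 1ℚ :- u) :* a :+ u :* b)) refl u M a b)
         (mix-nonneg u∈I a≥ b≥))

Bounded-+ : ∀ {M a N b} → Bounded M a → Bounded N b → Bounded (M + N) (a + b)
Bounded-+ {M} {a} {N} {b} (bounds a≤ a≥) (bounds b≤ b≥) = bounds
  (subst (0ℚ ≤_) (solve 4 (λ M a N b → (M :- a) :+ (N :- b) := (M :+ N) :- (a :+ b)) refl M a N b) (0≤+ a≤ b≤))
  (subst (0ℚ ≤_) (solve 4 (λ M a N b → (M :+ a) :+ (N :+ b) := (M :+ N) :+ (a :+ b)) refl M a N b) (0≤+ a≥ b≥))

Bounded-- : ∀ {M a N b} → Bounded M a → Bounded N b → Bounded (M + N) (a - b)
Bounded-- {M} {a} {N} {b} (bounds a≤ a≥) (bounds b≤ b≥) = bounds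
  (subst (0ℚ ≤_) (solve 4 (λ M a N b → (M :- a) :+ (N :+ b) := (M :+ N) :- (a :- b)) refl M a N b) (0≤+ a≤ b≥))
  (subst (0ℚ ≤_) (solve 4 (λ M a N b → (M :+ a) :+ (N :- b) := (M :+ N) :+ (a :- b)) refl M a N b) (0≤+ a≥ b≤))

-- The certificate is MN ∓ ab = ½((M ± a)(N ∓ b) + (M ∓ a)(N ± b)).
Bounded-* : ∀ {M a N b} → Bounded M a → Bounded N b → Bounded (M * N) (a * b)
Bounded-* {M} {a} {N} {b} (bounds a≤ a≥) (bounds b≤ b≥) = bounds
  (subst (0ℚ ≤_) (solve 4 (λ M a N b → con ½ :* ((M :- a) :* (N :+ b) :+ (M :+ a) :* (N :- b))
                                      := M :* N :- a :* b) refl M a N b)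
         (0≤* 0≤½ (0≤+ (0≤* a≤ b≥) (0≤* a≥ b≤))))
  (subst (0ℚ ≤_) (solve 4 (λ M a N b → con ½ :* ((M :+ a) :* (N :+ b) :+ (M :- a) :* (N :- b))
                                      := M :* N :+ a :* b) refl M a N b)
         (0≤* 0≤½ (0≤+ (0≤* a≥ b≥) (0≤* a≤ b≤))))

sum-linear : ∀ (α β : ℚ) (g h : Fin n → ℚ) →
  sum (λ i → α * g i + β * h i) ≡ α * sum g + β * sum h
sum-linear α β g h =
  trans (∑-distrib-+ (λ i → α * g i) (λ i → β * h i))
        (cong₂ _+_ (sym (*-distribˡ-sum α g)) (sym (*-distribˡ-sum β h)))

sum-scale-sub : ∀ (α : ℚ) (g h : Fin n → ℚ) → sum (λ i → α * g i - h i) ≡ α * sum g - sum h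
sum-scale-sub α g h =
  trans (sum-cong-≗ (λ i → solve 3 (λ α a b → α :* a :- b := α :* a :+ (:- con 1ℚ) :* b) refl α (g i) (h i)))
        (trans (sum-linear α (- 1ℚ) g h)
               (solve 3 (λ α a b → α :* a :+ (:- con 1ℚ) :* b := α :* a :- b) refl α (sum g) (sum h)))

sum-nonneg : {g : Fin n → ℚ} → (∀ i → 0ℚ ≤ g i) → 0ℚ ≤ sum g
sum-nonneg {zero}  _ = ℚP.≤-refl
sum-nonneg {suc n} h = 0≤+ (h zero) (sum-nonneg (h ∘ suc))

sum-bounded : ∀ {M} {g : Fin n → ℚ} → (∀ i → Bounded M (g i)) → Bounded (fromℕ n * M) (sum g)
sum-bounded {zero} {M} _ = Bounded-resp (solve 1 (λ M → con 0ℚ := con 0ℚ :* M) refl M)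
                                        (bounds ℚP.≤-refl ℚP.≤-refl)
sum-bounded {suc n} {M} h =
  Bounded-resp (trans (solve 2 (λ k M → M :+ k :* M := (k :+ con 1ℚ) :* M) refl (fromℕ n) M)
                      (cong (_* M) (sym (fromℕ-suc n))))
               (Bounded-+ (h zero) (sum-bounded (h ∘ suc)))

-- The multilinear extension, computed coordinate by coordinate.

_⇂_ : (Subset (suc n) → ℚ) → Bool → Subset n → ℚ
(h ⇂ b) S = h (b ∷ S)

-- The multilinear extension: the expectation of h(S) when each i lies in S
-- independently with probability x i.
ML : (Subset n → ℚ) → (Fin n → ℚ) → ℚ
ML {zero}  h x = h []
ML {suc n} h x = mix (x zero) (ML (h ⇂ false) (tail x)) (ML (h ⇂ true) (tail x))

∑ₗ : {A : Set} → (A → ℚ) → List A → ℚ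
∑ₗ g = foldr (λ S acc → g S + acc) 0ℚ

∑ₗ-++ : {A : Set} (g : A → ℚ) (xs ys : List A) → ∑ₗ g (xs ++ ys) ≡ ∑ₗ g xs + ∑ₗ g ys
∑ₗ-++ g []       ys = sym (ℚP.+-identityˡ _)
∑ₗ-++ g (x ∷ xs) ys = trans (cong (_+_ (g x)) (∑ₗ-++ g xs ys)) (sym (ℚP.+-assoc (g x) _ _))

∑ₗ-map : {A B : Set} (g : B → ℚ) (φ : A → B) (xs : List A) → ∑ₗ g (map φ xs) ≡ ∑ₗ (g ∘ φ) xs
∑ₗ-map g φ []       = refl
∑ₗ-map g φ (x ∷ xs) = cong (_+_ (g (φ x))) (∑ₗ-map g φ xs)

∑ₗ-scale : {A : Set} (c : ℚ) {g h : A → ℚ} → (∀ S → g S ≡ c * h S) → (xs : List A) →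
  ∑ₗ g xs ≡ c * ∑ₗ h xs
∑ₗ-scale c eq []           = sym (ℚP.*-zeroʳ c)
∑ₗ-scale c {h = h} eq (x ∷ xs) =
  trans (cong₂ _+_ (eq x) (∑ₗ-scale c eq xs)) (sym (ℚP.*-distribˡ-+ c (h x) _))

F-step : (h : Subset (suc n) → ℚ) (x : Fin (suc n) → ℚ) →
  F h x ≡ mix (x zero) (F (h ⇂ false) (tail x)) (F (h ⇂ true) (tail x))
F-step {n} h x = begin
  ∑ₗ term (map (outside ∷_) L ++ map (inside ∷_) L)
    ≡⟨ ∑ₗ-++ term (map (outside ∷_) L) (map (inside ∷_) L) ⟩
  ∑ₗ term (map (outside ∷_) L) + ∑ₗ term (map (inside ∷_) L)
    ≡⟨ cong₂ _+_ (∑ₗ-map term _ L) (∑ₗ-map term _ L) ⟩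
  ∑ₗ (term ∘ (outside ∷_)) L + ∑ₗ (term ∘ (inside ∷_)) L
    ≡⟨ cong₂ _+_ (∑ₗ-scale (1ℚ - x zero) (reorder false (1ℚ - x zero)) L)
                 (∑ₗ-scale (x zero) (reorder true (x zero)) L) ⟩
  mix (x zero) (F (h ⇂ false) (tail x)) (F (h ⇂ true) (tail x)) ∎
  where
  L = allSubsets n
  term : Subset (suc n) → ℚ
  term S = h S * weight S x
  reorder : ∀ b w S → h (b ∷ S) * (w * weight S (tail x)) ≡ w * (h (b ∷ S) * weight S (tail x))
  reorder b w S = solve 3 (λ a w c → a :* (w :* c) := w :* (a :* c)) refl (h (b ∷ S)) w (weight S (tail x))

F≡ML : (h : Subset n → ℚ) (x : Fin n → ℚ) → F h x ≡ ML h x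
F≡ML {zero}  h x = solve 1 (λ a → a :* con 1ℚ :+ con 0ℚ := a) refl (h [])
F≡ML {suc n} h x =
  trans (F-step h x) (cong₂ (mix (x zero)) (F≡ML (h ⇂ false) (tail x)) (F≡ML (h ⇂ true) (tail x)))

Box : (Fin n → ℚ) → Set
Box x = ∀ i → InUnit (x i)

ML-cong : (h : Subset n → ℚ) {x y : Fin n → ℚ} → (∀ i → x i ≡ y i) → ML h x ≡ ML h y
ML-cong {zero}  h eq = refl
ML-cong {suc n} h {x} {y} eq =
  trans (cong (λ u → mix u (ML (h ⇂ false) (tail x)) (ML (h ⇂ true) (tail x))) (eq zero))
        (cong₂ (mix (y zero)) (ML-cong (h ⇂ false) (eq ∘ suc)) (ML-cong (h ⇂ true) (eq ∘ suc)))

ML-sub : (g h : Subset n → ℚ) (x : Fin n → ℚ) → ML (λ S → g S - h S) x ≡ ML g x - ML h x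
ML-sub {zero}  g h x = refl
ML-sub {suc n} g h x =
  trans (cong₂ (mix (x zero)) (ML-sub (g ⇂ false) (h ⇂ false) (tail x)) (ML-sub (g ⇂ true) (h ⇂ true) (tail x)))
        (mix-sub (x zero) _ _ _ _)

ML-nonneg : {h : Subset n → ℚ} {x : Fin n → ℚ} → Box x → (∀ S → 0ℚ ≤ h S) → 0ℚ ≤ ML h x
ML-nonneg {zero}  _  h≥0 = h≥0 []
ML-nonneg {suc n} bx h≥0 =
  mix-nonneg (bx zero) (ML-nonneg (bx ∘ suc) (h≥0 ∘ (false ∷_))) (ML-nonneg (bx ∘ suc) (h≥0 ∘ (true ∷_)))

ML-bounded : ∀ {M} {h : Subset n → ℚ} {x : Fin n → ℚ} → Box x → (∀ S → Bounded M (h S)) → Bounded M (ML h x)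
ML-bounded {zero}  _  hM = hM []
ML-bounded {suc n} bx hM =
  Bounded-mix (bx zero) (ML-bounded (bx ∘ suc) (hM ∘ (false ∷_))) (ML-bounded (bx ∘ suc) (hM ∘ (true ∷_)))

-- ∂ i h x is the partial derivative of ML h in direction i; ML h is affine
-- in x i, so it does not depend on x i.
∂ : Fin n → (Subset n → ℚ) → (Fin n → ℚ) → ℚ
∂ {suc n} zero    h x = ML (h ⇂ true) (tail x) - ML (h ⇂ false) (tail x)
∂ {suc n} (suc i) h x = mix (x zero) (∂ i (h ⇂ false) (tail x)) (∂ i (h ⇂ true) (tail x))

deriv : (Fin n → ℚ) → (Subset n → ℚ) → (Fin n → ℚ) → ℚ
deriv v h x = sum (λ i → v i * ∂ i h x)

deriv-step : (v : Fin (suc n) → ℚ) (h : Subset (suc n) → ℚ) (x : Fin (suc n) → ℚ) →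
  deriv v h x ≡ v zero * ∂ zero h x + mix (x zero) (deriv (tail v) (h ⇂ false) (tail x))
                                                  (deriv (tail v) (h ⇂ true) (tail x))
deriv-step v h x = cong (_+_ (v zero * ∂ zero h x))
  (trans (sum-cong-≗ (λ i → solve 4 (λ w u a b → w :* :mix u a b := (con 1ℚ :- u) :* (w :* a) :+ u :* (w :* b))
                                    refl (v (suc i)) (x zero) (∂ i (h ⇂ false) (tail x)) (∂ i (h ⇂ true) (tail x))))
         (sum-linear (1ℚ - x zero) (x zero) (λ i → v (suc i) * ∂ i (h ⇂ false) (tail x))
                                            (λ i → v (suc i) * ∂ i (h ⇂ true) (tail x))))

∂-bounded : ∀ {M} {h : Subset n → ℚ} {x : Fin n → ℚ} → Box x → (∀ S → Bounded M (h S)) →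
  ∀ i → Bounded (M + M) (∂ i h x)
∂-bounded {suc n} bx hM zero =
  Bounded-- (ML-bounded (bx ∘ suc) (hM ∘ (true ∷_))) (ML-bounded (bx ∘ suc) (hM ∘ (false ∷_)))
∂-bounded {suc n} bx hM (suc i) =
  Bounded-mix (bx zero) (∂-bounded (bx ∘ suc) (hM ∘ (false ∷_)) i) (∂-bounded (bx ∘ suc) (hM ∘ (true ∷_)) i)

deriv-bounded : ∀ {δ M} {v : Fin n → ℚ} {h : Subset n → ℚ} {x : Fin n → ℚ} → (∀ i → Bounded δ (v i)) →
  Box x → (∀ S → Bounded M (h S)) → Bounded (fromℕ n * (δ * (M + M))) (deriv v h x)
deriv-bounded hv bx hM = sum-bounded (λ i → Bounded-* (hv i) (∂-bounded bx hM i))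

ML-change : (h : Subset n → ℚ) (x y : Fin n → ℚ) (i : Fin n) → (∀ j → ¬ j ≡ i → x j ≡ y j) →
  ML h y - ML h x ≡ (y i - x i) * ∂ i h x
ML-change {suc n} h x y zero agree = begin
  mix (y zero) (ML h₀ (tail y)) (ML h₁ (tail y)) - mix (x zero) (ML h₀ (tail x)) (ML h₁ (tail x))
    ≡⟨ cong₂ (λ a b → mix (y zero) a b - mix (x zero) (ML h₀ (tail x)) (ML h₁ (tail x)))
             (ML-cong h₀ (sym ∘ same-tail)) (ML-cong h₁ (sym ∘ same-tail)) ⟩
  mix (y zero) (ML h₀ (tail x)) (ML h₁ (tail x)) - mix (x zero) (ML h₀ (tail x)) (ML h₁ (tail x))
    ≡⟨ solve 4 (λ v u a b → :mix v a b :- :mix u a b := (v :- u) :* (b :- a)) refl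
               (y zero) (x zero) (ML h₀ (tail x)) (ML h₁ (tail x)) ⟩
  (y zero - x zero) * ∂ zero h x ∎
  where
  h₀ = h ⇂ false
  h₁ = h ⇂ true
  same-tail : ∀ j → x (suc j) ≡ y (suc j)
  same-tail j = agree (suc j) (λ ())
ML-change {suc n} h x y (suc i) agree = begin
  mix (y zero) (ML h₀ (tail y)) (ML h₁ (tail y)) - mix (x zero) (ML h₀ (tail x)) (ML h₁ (tail x))
    ≡⟨ cong (λ u → mix u (ML h₀ (tail y)) (ML h₁ (tail y)) - mix (x zero) (ML h₀ (tail x)) (ML h₁ (tail x)))
            (sym (agree zero (λ ()))) ⟩
  mix (x zero) (ML h₀ (tail y)) (ML h₁ (tail y)) - mix (x zero) (ML h₀ (tail x)) (ML h₁ (tail x))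
    ≡⟨ sym (mix-sub (x zero) _ _ _ _) ⟩
  mix (x zero) (ML h₀ (tail y) - ML h₀ (tail x)) (ML h₁ (tail y) - ML h₁ (tail x))
    ≡⟨ cong₂ (mix (x zero)) (ML-change h₀ (tail x) (tail y) i agree-tail) (ML-change h₁ (tail x) (tail y) i agree-tail) ⟩
  mix (x zero) ((y (suc i) - x (suc i)) * ∂ i h₀ (tail x)) ((y (suc i) - x (suc i)) * ∂ i h₁ (tail x))
    ≡⟨ mix-scale (x zero) (y (suc i) - x (suc i)) (∂ i h₀ (tail x)) (∂ i h₁ (tail x)) ⟩
  (y (suc i) - x (suc i)) * ∂ (suc i) h x ∎
  where
  h₀ = h ⇂ false
  h₁ = h ⇂ true
  agree-tail : ∀ j → ¬ j ≡ i → x (suc j) ≡ y (suc j)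
  agree-tail j j≢i = agree (suc j) (λ sj≡si → j≢i (suc-injective sj≡si))

-- The second-order Taylor bound.

-- K n = 2n² - 2n bounds the second-order remainder of ML on n coordinates.
K : ℕ → ℚ
K n = fromℕ n * fromℕ n + fromℕ n * fromℕ n - (fromℕ n + fromℕ n)

:K : ∀ {m} → Polynomial m → Polynomial m
:K k = k :* k :+ k :* k :- (k :+ k)

K-step : ∀ n → K (suc n) ≡ K n + (+ 4 / 1) * fromℕ n
K-step n = trans (cong (λ k → k * k + k * k - (k + k)) (fromℕ-suc n))
  (solve 1 (λ k → :K (k :+ con 1ℚ) := :K k :+ con (+ 4 / 1) :* k) refl (fromℕ n))

K-nonneg : ∀ n → 0ℚ ≤ K n
K-nonneg zero    = ℚP.≤-refl
K-nonneg (suc n) = subst (0ℚ ≤_) (sym (K-step n))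
  (0≤+ (K-nonneg n) (0≤* (fromℕ-nonneg 4) (fromℕ-nonneg n)))

taylor : (h : Subset n → ℚ) {x y : Fin n → ℚ} {δ M : ℚ} → Box x → Box y →
  (∀ i → Bounded δ (y i - x i)) → (∀ S → Bounded M (h S)) →
  Bounded (K n * (δ * δ) * M) (ML h y - ML h x - deriv (λ i → y i - x i) h x)
taylor {zero} h {δ = δ} {M} _ _ _ _ =
  bounds (subst (0ℚ ≤_) (sym vanish) ℚP.≤-refl) (subst (0ℚ ≤_) (sym vanish′) ℚP.≤-refl)
  where
  vanish : 0ℚ * (δ * δ) * M - (h [] - h [] - 0ℚ) ≡ 0ℚ
  vanish = solve 3 (λ d m a → con 0ℚ :* (d :* d) :* m :- (a :- a :- con 0ℚ) := con 0ℚ) refl δ M (h [])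
  vanish′ : 0ℚ * (δ * δ) * M + (h [] - h [] - 0ℚ) ≡ 0ℚ
  vanish′ = solve 3 (λ d m a → con 0ℚ :* (d :* d) :* m :+ (a :- a :- con 0ℚ) := con 0ℚ) refl δ M (h [])
taylor {suc n} h {x} {y} {δ} {M} bx by close hM =
  Bounded-resp grow (subst (Bounded _) (sym split) (Bounded-+ (Bounded-mix (by zero) IH₀ IH₁) cross))
  where
  h₀ = h ⇂ false
  h₁ = h ⇂ true
  L₀ = deriv (λ i → y (suc i) - x (suc i)) h₀ (tail x)
  L₁ = deriv (λ i → y (suc i) - x (suc i)) h₁ (tail x)
  IH₀ = taylor h₀ (bx ∘ suc) (by ∘ suc) (close ∘ suc) (hM ∘ (false ∷_))
  IH₁ = taylor h₁ (bx ∘ suc) (by ∘ suc) (close ∘ suc) (hM ∘ (true ∷_))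
  B = fromℕ n * (δ * (M + M))
  cross : Bounded (δ * (B + B)) ((y zero - x zero) * (L₁ - L₀))
  cross = Bounded-* (close zero) (Bounded-- (deriv-bounded (close ∘ suc) (bx ∘ suc) (hM ∘ (true ∷_)))
                                            (deriv-bounded (close ∘ suc) (bx ∘ suc) (hM ∘ (false ∷_))))
  split : ML h y - ML h x - deriv (λ i → y i - x i) h x
        ≡ mix (y zero) (ML h₀ (tail y) - ML h₀ (tail x) - L₀) (ML h₁ (tail y) - ML h₁ (tail x) - L₁)
          + (y zero - x zero) * (L₁ - L₀)
  split = trans (cong (_-_ (ML h y - ML h x)) (deriv-step (λ i → y i - x i) h x))
    (solve 8 (λ u v a c a′ c′ l₀ l₁ → :mix v a′ c′ :- :mix u a c :- ((v :- u) :* (c :- a) :+ :mix u l₀ l₁)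
                                       := :mix v (a′ :- a :- l₀) (c′ :- c :- l₁) :+ (v :- u) :* (l₁ :- l₀)) refl
       (x zero) (y zero) (ML h₀ (tail x)) (ML h₁ (tail x)) (ML h₀ (tail y)) (ML h₁ (tail y)) L₀ L₁)
  grow : K n * (δ * δ) * M + δ * (B + B) ≡ K (suc n) * (δ * δ) * M
  grow = trans (solve 4 (λ k m d M → k :* (d :* d) :* M :+ d :* (m :* (d :* (M :+ M)) :+ m :* (d :* (M :+ M)))
                                     := (k :+ con (+ 4 / 1) :* m) :* (d :* d) :* M) refl (K n) (fromℕ n) δ M)
               (cong (λ k → k * (δ * δ) * M) (sym (K-step n)))

-- Submodularity.

open SubsetP using (∪-assoc; ∪-comm; ∪-idem; ∪-identityˡ; ∪-zeroʳ; ∪-inverseˡ; ∪-inverseʳ;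
  ∪-distribʳ-∩; ∪-abs-∩; ∩-assoc; ∩-comm; ∩-idem; ∩-identityˡ; ∩-identityʳ; ∩-zeroˡ; ∩-zeroʳ;
  ∩-inverseˡ; ∩-inverseʳ; ∩-distribˡ-∪; ∩-distribʳ-∪; ∩-abs-∪)

-- Interchange laws (S ∙ C) ∙ (T ∙ C) = (S ∙ T) ∙ (C ∙ C) for ∪ and ∩.
module ∪-Properties {n} =
  CommSemigroupProperties (CommutativeMonoid.commutativeSemigroup (SubsetP.∪-commutativeMonoid n))
module ∩-Properties {n} =
  CommSemigroupProperties (CommutativeMonoid.commutativeSemigroup (SubsetP.∩-commutativeMonoid n))

-- S ≼ T: inclusion of subsets, in the lattice-theoretic form used below.
infix 4 _≼_
_≼_ : Subset n → Subset n → Set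
S ≼ T = (S ∪ T ≡ T) × (S ∩ T ≡ S)

≼-∪ : (S C : Subset n) → S ≼ S ∪ C
≼-∪ S C = trans (sym (∪-assoc S S C)) (cong (_∪ C) (∪-idem S)) , ∩-abs-∪ S C

∩-≼ : (S C : Subset n) → S ∩ C ≼ S
∩-≼ S C = trans (∪-comm (S ∩ C) S) (∪-abs-∩ S C) ,
          trans (∩-comm (S ∩ C) S) (trans (sym (∩-assoc S S C)) (cong (_∩ C) (∩-idem S)))

⊥-≼ : (T : Subset n) → ⊥ ≼ T
⊥-≼ T = ∪-identityˡ T , ∩-zeroˡ T

≼-⊤ : (S : Subset n) → S ≼ ⊤
≼-⊤ S = ∪-zeroʳ S , ∩-identityʳ S

Submodular-⇂ : {f : Subset (suc n) → ℚ} → Submodular f → ∀ b → Submodular (f ⇂ b)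
Submodular-⇂ sub true  S T = sub (true ∷ S) (true ∷ T)
Submodular-⇂ sub false S T = sub (false ∷ S) (false ∷ T)

Submodular-∪ : {f : Subset n → ℚ} → Submodular f → (C : Subset n) → Submodular (λ S → f (S ∪ C))
Submodular-∪ {f = f} sub C S T =
  subst₂ (λ U V → f U + f V ≤ f (S ∪ C) + f (T ∪ C)) union meet (sub (S ∪ C) (T ∪ C))
  where
  union : (S ∪ C) ∪ (T ∪ C) ≡ (S ∪ T) ∪ C
  union = trans (∪-Properties.interchange S C T C) (cong ((S ∪ T) ∪_) (∪-idem C))
  meet : (S ∪ C) ∩ (T ∪ C) ≡ (S ∩ T) ∪ C
  meet = sym (∪-distribʳ-∩ C S T)

Submodular-∩ : {f : Subset n → ℚ} → Submodular f → (C : Subset n) → Submodular (λ S → f (S ∩ C))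
Submodular-∩ {f = f} sub C S T =
  subst₂ (λ U V → f U + f V ≤ f (S ∩ C) + f (T ∩ C)) union meet (sub (S ∩ C) (T ∩ C))
  where
  union : (S ∩ C) ∪ (T ∩ C) ≡ (S ∪ T) ∩ C
  union = sym (∩-distribʳ-∪ C S T)
  meet : (S ∩ C) ∩ (T ∩ C) ≡ (S ∩ T) ∩ C
  meet = trans (∩-Properties.interchange S C T C) (cong ((S ∩ T) ∩_) (∩-idem C))

Δ : (Subset (suc n) → ℚ) → Subset n → ℚ
Δ f S = f (inside ∷ S) - f (outside ∷ S)

Δ-antitone : {f : Subset (suc n) → ℚ} → Submodular f → {S T : Subset n} → S ≼ T → 0ℚ ≤ Δ f S - Δ f T
Δ-antitone {f = f} sub {S} {T} (S∪T≡T , S∩T≡S) = subst (0ℚ ≤_) rearrange (≤⇒0≤- submodularity)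
  where
  submodularity : f (true ∷ T) + f (false ∷ S) ≤ f (true ∷ S) + f (false ∷ T)
  submodularity = subst₂ (λ U V → f (true ∷ U) + f (false ∷ V) ≤ f (true ∷ S) + f (false ∷ T))
                         S∪T≡T S∩T≡S (sub (true ∷ S) (false ∷ T))
  rearrange : f (true ∷ S) + f (false ∷ T) - (f (true ∷ T) + f (false ∷ S)) ≡ Δ f S - Δ f T
  rearrange = solve 4 (λ a b c d → a :+ b :- (c :+ d) := (a :- d) :- (c :- b)) refl
                (f (true ∷ S)) (f (false ∷ T)) (f (true ∷ T)) (f (false ∷ S))

ML-Δ-antitone : {f : Subset (suc n) → ℚ} → Submodular f → (φ ψ : Subset n → Subset n) →
  (∀ S → φ S ≼ ψ S) → {x : Fin n → ℚ} → Box x →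
  0ℚ ≤ (ML (f ⇂ true ∘ φ) x - ML (f ⇂ false ∘ φ) x) - (ML (f ⇂ true ∘ ψ) x - ML (f ⇂ false ∘ ψ) x)
ML-Δ-antitone {f = f} sub φ ψ φ≼ψ {x} bx =
  subst (0ℚ ≤_) (trans (ML-sub (Δ f ∘ φ) (Δ f ∘ ψ) x)
                       (cong₂ _-_ (ML-sub (f ⇂ true ∘ φ) (f ⇂ false ∘ φ) x)
                                  (ML-sub (f ⇂ true ∘ ψ) (f ⇂ false ∘ ψ) x)))
        (ML-nonneg bx (λ S → Δ-antitone {f = f} sub (φ≼ψ S)))

cover : (A C : Subset n) → (A ∪ C) ∪ ∁ A ≡ ⊤
cover A C = begin
  (A ∪ C) ∪ ∁ A  ≡⟨ cong (_∪ ∁ A) (∪-comm A C) ⟩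
  (C ∪ A) ∪ ∁ A  ≡⟨ ∪-assoc C A (∁ A) ⟩
  C ∪ (A ∪ ∁ A)  ≡⟨ cong (C ∪_) (∪-inverseʳ A) ⟩
  C ∪ ⊤          ≡⟨ ∪-zeroʳ C ⟩
  ⊤              ∎

trim : (A C : Subset n) → (A ∪ C) ∩ ∁ A ≡ C ∩ ∁ A
trim A C = begin
  (A ∪ C) ∩ ∁ A          ≡⟨ ∩-distribʳ-∪ (∁ A) A C ⟩
  (A ∩ ∁ A) ∪ (C ∩ ∁ A)  ≡⟨ cong (_∪ (C ∩ ∁ A)) (∩-inverseʳ A) ⟩
  ⊥ ∪ (C ∩ ∁ A)          ≡⟨ ∪-identityˡ (C ∩ ∁ A) ⟩
  C ∩ ∁ A                ∎

rejoin : (A C : Subset n) → (C ∩ ∁ A) ∪ (A ∩ C) ≡ C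
rejoin A C = begin
  (C ∩ ∁ A) ∪ (A ∩ C)  ≡⟨ cong ((C ∩ ∁ A) ∪_) (∩-comm A C) ⟩
  (C ∩ ∁ A) ∪ (C ∩ A)  ≡⟨ sym (∩-distribˡ-∪ C (∁ A) A) ⟩
  C ∩ (∁ A ∪ A)        ≡⟨ cong (C ∩_) (∪-inverseˡ A) ⟩
  C ∩ ⊤                ≡⟨ ∩-identityʳ C ⟩
  C                    ∎

disjoint : (A C : Subset n) → (C ∩ ∁ A) ∩ (A ∩ C) ≡ ⊥
disjoint A C = begin
  (C ∩ ∁ A) ∩ (A ∩ C)  ≡⟨ ∩-assoc C (∁ A) (A ∩ C) ⟩
  C ∩ (∁ A ∩ (A ∩ C))  ≡⟨ cong (C ∩_) (sym (∩-assoc (∁ A) A C)) ⟩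
  C ∩ ((∁ A ∩ A) ∩ C)  ≡⟨ cong (λ Y → C ∩ (Y ∩ C)) (∩-inverseˡ A) ⟩
  C ∩ (⊥ ∩ C)          ≡⟨ cong (C ∩_) (∩-zeroˡ C) ⟩
  C ∩ ⊥                ≡⟨ ∩-zeroʳ C ⟩
  ⊥                    ∎

-- For nonnegative submodular f:  f C ≤ f(A ∪ C) + f(A ∩ C) + f(X ∖ A),
-- by submodularity on the pairs (A ∪ C, X ∖ A) and (C ∖ A, A ∩ C).
complement-bound : {f : Subset n → ℚ} → Nonnegative f → Submodular f → (A C : Subset n) →
  0ℚ ≤ f (A ∪ C) + f (A ∩ C) + f (∁ A) - f C
complement-bound {f = f} f≥0 sub A C =
  subst (0ℚ ≤_) rearrange (0≤+ (0≤+ (0≤+ (≤⇒0≤- first) (≤⇒0≤- second)) (f≥0 ⊤)) (f≥0 ⊥))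
  where
  D = C ∩ ∁ A
  first : f ⊤ + f D ≤ f (A ∪ C) + f (∁ A)
  first = subst₂ (λ U V → f U + f V ≤ f (A ∪ C) + f (∁ A)) (cover A C) (trim A C) (sub (A ∪ C) (∁ A))
  second : f C + f ⊥ ≤ f D + f (A ∩ C)
  second = subst₂ (λ U V → f U + f V ≤ f D + f (A ∩ C)) (rejoin A C) (disjoint A C) (sub D (A ∩ C))
  rearrange : f (A ∪ C) + f (∁ A) - (f ⊤ + f D) + (f D + f (A ∩ C) - (f C + f ⊥)) + f ⊤ + f ⊥
            ≡ f (A ∪ C) + f (A ∩ C) + f (∁ A) - f C
  rearrange = solve 7 (λ u a t d i c b → u :+ a :- (t :+ d) :+ (d :+ i :- (c :+ b)) :+ t :+ b := u :+ i :+ a :- c) refl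
                (f (A ∪ C)) (f (∁ A)) (f ⊤) (f D) (f (A ∩ C)) (f C) (f ⊥)

𝟙 : Subset n → Fin n → ℚ
𝟙 C i = if lookup C i then 1ℚ else 0ℚ

concavity-slack : (Subset n → ℚ) → (Fin n → ℚ) → Subset n → ℚ
concavity-slack f x C =
  deriv (λ i → 𝟙 C i - x i) f x - (ML (λ S → f (S ∪ C)) x + ML (λ S → f (S ∩ C)) x - (ML f x + ML f x))

module ConcavityStep (f : Subset (suc n) → ℚ) (x : Fin (suc n) → ℚ) (C : Subset n) where
  u : ℚ
  u = x zero
  Σ e U I : Bool → ℚ
  Σ b = deriv (λ i → 𝟙 C i - x (suc i)) (f ⇂ b) (tail x)
  e b = ML (f ⇂ b) (tail x)
  U b = ML (λ S → f (b ∷ (S ∪ C))) (tail x)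
  I b = ML (λ S → f (b ∷ (S ∩ C))) (tail x)

-- ⟨1_C - x, ∇ML f x⟩ ≥ ML f(x ∨ 1_C) + ML f(x ∧ 1_C) - 2 ML f x: the slack is
-- an average of the slacks one dimension down plus a diminishing-returns gap.
concavity : (f : Subset n → ℚ) → Submodular f → {x : Fin n → ℚ} → Box x → (C : Subset n) →
  0ℚ ≤ concavity-slack f x C
concavity {zero} f sub _ [] =
  subst (0ℚ ≤_) (sym (solve 1 (λ a → con 0ℚ :- (a :+ a :- (a :+ a)) := con 0ℚ) refl (f []))) ℚP.≤-refl
concavity {suc n} f sub {x} bx (true ∷ C) =
  subst (0ℚ ≤_) (sym decompose)
        (0≤+ (mix-nonneg (bx zero) (IH false) (IH true)) (0≤* (InUnit.≤1 (bx zero)) gap))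
  where
  open ConcavityStep f x C
  IH = λ b → concavity (f ⇂ b) (Submodular-⇂ {f = f} sub b) (bx ∘ suc) C
  gap = ML-Δ-antitone {f = f} sub (λ S → S) (_∪ C) (λ S → ≼-∪ S C) (bx ∘ suc)
  decompose : concavity-slack f x (true ∷ C)
            ≡ mix u (concavity-slack (f ⇂ false) (tail x) C) (concavity-slack (f ⇂ true) (tail x) C)
              + (1ℚ - u) * ((e true - e false) - (U true - U false))
  decompose = trans (cong (_- (ML (λ S → f (S ∪ (true ∷ C))) x + ML (λ S → f (S ∩ (true ∷ C))) x - (ML f x + ML f x)))
                           (deriv-step (λ i → 𝟙 (true ∷ C) i - x i) f x))
    (solve 9 (λ u s₀ s₁ e₀ e₁ U₀ U₁ I₀ I₁ →
        (con 1ℚ :- u) :* (e₁ :- e₀) :+ :mix u s₀ s₁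
          :- (:mix u U₁ U₁ :+ :mix u I₀ I₁ :- (:mix u e₀ e₁ :+ :mix u e₀ e₁))
        := :mix u (s₀ :- (U₀ :+ I₀ :- (e₀ :+ e₀))) (s₁ :- (U₁ :+ I₁ :- (e₁ :+ e₁)))
           :+ (con 1ℚ :- u) :* ((e₁ :- e₀) :- (U₁ :- U₀))) refl
      u (Σ false) (Σ true) (e false) (e true) (U false) (U true) (I false) (I true))
concavity {suc n} f sub {x} bx (false ∷ C) =
  subst (0ℚ ≤_) (sym decompose)
        (0≤+ (mix-nonneg (bx zero) (IH false) (IH true)) (0≤* (InUnit.≥0 (bx zero)) gap))
  where
  open ConcavityStep f x C
  IH = λ b → concavity (f ⇂ b) (Submodular-⇂ {f = f} sub b) (bx ∘ suc) C
  gap = ML-Δ-antitone {f = f} sub (_∩ C) (λ S → S) (λ S → ∩-≼ S C) (bx ∘ suc)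
  decompose : concavity-slack f x (false ∷ C)
            ≡ mix u (concavity-slack (f ⇂ false) (tail x) C) (concavity-slack (f ⇂ true) (tail x) C)
              + u * ((I true - I false) - (e true - e false))
  decompose = trans (cong (_- (ML (λ S → f (S ∪ (false ∷ C))) x + ML (λ S → f (S ∩ (false ∷ C))) x - (ML f x + ML f x)))
                           (deriv-step (λ i → 𝟙 (false ∷ C) i - x i) f x))
    (solve 9 (λ u s₀ s₁ e₀ e₁ U₀ U₁ I₀ I₁ →
        (con 0ℚ :- u) :* (e₁ :- e₀) :+ :mix u s₀ s₁
          :- (:mix u U₀ U₁ :+ :mix u I₀ I₀ :- (:mix u e₀ e₁ :+ :mix u e₀ e₁))
        := :mix u (s₀ :- (U₀ :+ I₀ :- (e₀ :+ e₀))) (s₁ :- (U₁ :+ I₁ :- (e₁ :+ e₁)))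
           :+ u :* ((I₁ :- I₀) :- (e₁ :- e₀))) refl
      u (Σ false) (Σ true) (e false) (e true) (U false) (U true) (I false) (I true))

InUnit-flip : ∀ {u} → InUnit u → InUnit (1ℚ - u)
InUnit-flip {u} (unit u≥0 1-u≥0) =
  unit 1-u≥0 (subst (0ℚ ≤_) (sym (solve 1 (λ u → con 1ℚ :- (con 1ℚ :- u) := u) refl u)) u≥0)

upper-half : ∀ {p} → 0ℚ ≤ p + p - 1ℚ → 0ℚ ≤ 1ℚ - p → InUnit p
upper-half {p} 2p-1≥0 1-p≥0 =
  unit (subst (0ℚ ≤_) (solve 1 (λ p → (p :+ p :- con 1ℚ) :+ (con 1ℚ :- p) := p) refl p) (0≤+ 2p-1≥0 1-p≥0)) 1-p≥0

xp-box : ∀ {p} → InUnit p → (A : Subset n) → Box (xp p A)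
xp-box p∈I A i with lookup A i
... | true  = p∈I
... | false = InUnit-flip p∈I

signOf : Bool → ℚ
signOf b = if b then 1ℚ else - 1ℚ

sgn : Subset n → Fin n → ℚ
sgn A i = signOf (lookup A i)

Bounded-sign : ∀ {δ t} b → Bounded δ t → Bounded δ (t * signOf b)
Bounded-sign {δ} {t} true  (bounds t≤ t≥) = bounds
  (subst (0ℚ ≤_) (solve 2 (λ d t → d :- t := d :- t :* con 1ℚ) refl δ t) t≤)
  (subst (0ℚ ≤_) (solve 2 (λ d t → d :+ t := d :+ t :* con 1ℚ) refl δ t) t≥)
Bounded-sign {δ} {t} false (bounds t≤ t≥) = bounds
  (subst (0ℚ ≤_) (solve 2 (λ d t → d :+ t := d :- t :* (:- con 1ℚ)) refl δ t) t≥)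
  (subst (0ℚ ≤_) (solve 2 (λ d t → d :- t := d :+ t :* (:- con 1ℚ)) refl δ t) t≤)

xp-shift : ∀ p t (A : Subset n) i → xp (p + t) A i - xp p A i ≡ t * sgn A i
xp-shift p t A i with lookup A i
... | true  = solve 2 (λ p t → (p :+ t) :- p := t :* con 1ℚ) refl p t
... | false = solve 2 (λ p t → (con 1ℚ :- (p :+ t)) :- (con 1ℚ :- p) := t :* (:- con 1ℚ)) refl p t

xp-centre : ∀ {r} → r ≡ ½ → (A : Subset n) → ∀ i → xp r A i ≡ ½
xp-centre refl A i with lookup A i
... | true  = refl
... | false = refl

xp-flip : ∀ p (A : Subset n) i → xp p (flipAt A i) i - xp p A i ≡ - ((p + p - 1ℚ) * sgn A i)
xp-flip p A i = trans (cong (λ b → (if b then p else 1ℚ - p) - xp p A i) (VecP.lookup∘updateAt i A))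
                      (flip-bool (lookup A i))
  where
  flip-bool : ∀ b → (if not b then p else 1ℚ - p) - (if b then p else 1ℚ - p) ≡ - ((p + p - 1ℚ) * signOf b)
  flip-bool true  = solve 1 (λ p → (con 1ℚ :- p) :- p := :- ((p :+ p :- con 1ℚ) :* con 1ℚ)) refl p
  flip-bool false = solve 1 (λ p → p :- (con 1ℚ :- p) := :- ((p :+ p :- con 1ℚ) :* (:- con 1ℚ))) refl p

xp-flip-elsewhere : ∀ p (A : Subset n) i j → ¬ j ≡ i → xp p A j ≡ xp p (flipAt A i) j
xp-flip-elsewhere p A i j j≢i = cong (λ b → if b then p else 1ℚ - p) (sym (VecP.lookup∘updateAt′ j i j≢i A))

lower-slack : (Subset n → ℚ) → ℚ → Subset n → ℚ
lower-slack h p A = ML h (xp p A) - ((1ℚ - p) * h ⊤ + (p + p - 1ℚ) * h A + (1ℚ - p) * h ⊥)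

-- The slack is nonnegative: it is an average of the slacks one dimension
-- down plus diminishing-returns gaps along ∅ ⊆ A ⊆ X.
xp-lower-bound : (h : Subset n → ℚ) → Submodular h → ∀ {p} → 0ℚ ≤ p + p - 1ℚ → 0ℚ ≤ 1ℚ - p →
  (A : Subset n) → 0ℚ ≤ lower-slack h p A
xp-lower-bound {zero} h sub {p} _ _ [] =
  subst (0ℚ ≤_) (sym (solve 2 (λ p a → a :- ((con 1ℚ :- p) :* a :+ (p :+ p :- con 1ℚ) :* a :+ (con 1ℚ :- p) :* a)
                                     := con 0ℚ) refl p (h [])))
        ℚP.≤-refl
xp-lower-bound {suc n} h sub {p} 2p-1≥0 1-p≥0 (true ∷ A) =
  subst (0ℚ ≤_) (sym decompose)
    (0≤+ (mix-nonneg (upper-half {p} 2p-1≥0 1-p≥0) (IH false) (IH true))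
         (0≤* 1-p≥0 (0≤+ (0≤* 1-p≥0 (Δ-antitone {f = h} sub (⊥-≼ ⊤)))
                         (0≤* 2p-1≥0 (Δ-antitone {f = h} sub (⊥-≼ A))))))
  where
  IH = λ b → xp-lower-bound (h ⇂ b) (Submodular-⇂ {f = h} sub b) {p} 2p-1≥0 1-p≥0 A
  decompose : lower-slack h p (true ∷ A)
            ≡ mix p (lower-slack (h ⇂ false) p A) (lower-slack (h ⇂ true) p A)
              + (1ℚ - p) * ((1ℚ - p) * (Δ h ⊥ - Δ h ⊤) + (p + p - 1ℚ) * (Δ h ⊥ - Δ h A))
  decompose = solve 9 (λ p e₀ e₁ a₀ a₁ t₀ t₁ b₀ b₁ →
      :mix p e₀ e₁ :- ((con 1ℚ :- p) :* t₁ :+ (p :+ p :- con 1ℚ) :* a₁ :+ (con 1ℚ :- p) :* b₀)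
      := :mix p (e₀ :- ((con 1ℚ :- p) :* t₀ :+ (p :+ p :- con 1ℚ) :* a₀ :+ (con 1ℚ :- p) :* b₀))
                (e₁ :- ((con 1ℚ :- p) :* t₁ :+ (p :+ p :- con 1ℚ) :* a₁ :+ (con 1ℚ :- p) :* b₁))
         :+ (con 1ℚ :- p) :* ((con 1ℚ :- p) :* ((b₁ :- b₀) :- (t₁ :- t₀))
                              :+ (p :+ p :- con 1ℚ) :* ((b₁ :- b₀) :- (a₁ :- a₀)))) refl
    p (ML (h ⇂ false) (xp p A)) (ML (h ⇂ true) (xp p A)) (h (false ∷ A)) (h (true ∷ A))
      (h (false ∷ ⊤)) (h (true ∷ ⊤)) (h (false ∷ ⊥)) (h (true ∷ ⊥))
xp-lower-bound {suc n} h sub {p} 2p-1≥0 1-p≥0 (false ∷ A) =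
  subst (0ℚ ≤_) (sym decompose)
    (0≤+ (mix-nonneg (InUnit-flip (upper-half {p} 2p-1≥0 1-p≥0)) (IH false) (IH true))
         (0≤* 1-p≥0 (0≤+ (0≤* 2p-1≥0 (Δ-antitone {f = h} sub (≼-⊤ A)))
                         (0≤* 1-p≥0 (Δ-antitone {f = h} sub (⊥-≼ ⊤))))))
  where
  IH = λ b → xp-lower-bound (h ⇂ b) (Submodular-⇂ {f = h} sub b) {p} 2p-1≥0 1-p≥0 A
  decompose : lower-slack h p (false ∷ A)
            ≡ mix (1ℚ - p) (lower-slack (h ⇂ false) p A) (lower-slack (h ⇂ true) p A)
              + (1ℚ - p) * ((p + p - 1ℚ) * (Δ h A - Δ h ⊤) + (1ℚ - p) * (Δ h ⊥ - Δ h ⊤))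
  decompose = solve 9 (λ p e₀ e₁ a₀ a₁ t₀ t₁ b₀ b₁ →
      :mix (con 1ℚ :- p) e₀ e₁ :- ((con 1ℚ :- p) :* t₁ :+ (p :+ p :- con 1ℚ) :* a₀ :+ (con 1ℚ :- p) :* b₀)
      := :mix (con 1ℚ :- p) (e₀ :- ((con 1ℚ :- p) :* t₀ :+ (p :+ p :- con 1ℚ) :* a₀ :+ (con 1ℚ :- p) :* b₀))
                            (e₁ :- ((con 1ℚ :- p) :* t₁ :+ (p :+ p :- con 1ℚ) :* a₁ :+ (con 1ℚ :- p) :* b₁))
         :+ (con 1ℚ :- p) :* ((p :+ p :- con 1ℚ) :* ((a₁ :- a₀) :- (t₁ :- t₀))
                              :+ (con 1ℚ :- p) :* ((b₁ :- b₀) :- (t₁ :- t₀)))) refl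
    p (ML (h ⇂ false) (xp p A)) (ML (h ⇂ true) (xp p A)) (h (false ∷ A)) (h (true ∷ A))
      (h (false ∷ ⊤)) (h (true ∷ ⊤)) (h (false ∷ ⊥)) (h (true ∷ ⊥))

-- The key inequality at a local optimum.

-- At a local optimum of phase p > ½, flipping i moves coordinate i away
-- from the optimum direction, so sgn_A(i) ∂ i ≥ 0.
local-opt-sign : (f : Subset n → ℚ) {p : ℚ} → 0ℚ < p + p - 1ℚ → (A : Subset n) →
  (∀ i → ML f (xp p (flipAt A i)) ≤ ML f (xp p A)) → ∀ i → 0ℚ ≤ sgn A i * ∂ i f (xp p A)
local-opt-sign f {p} 2p-1>0 A lo i = 0≤-cancelˡ 2p-1>0 (subst (0ℚ ≤_) gain (≤⇒0≤- (lo i)))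
  where
  x = xp p A
  y = xp p (flipAt A i)
  gain : ML f x - ML f y ≡ (p + p - 1ℚ) * (sgn A i * ∂ i f x)
  gain = begin
    ML f x - ML f y                          ≡⟨ solve 2 (λ a b → a :- b := :- (b :- a)) refl (ML f x) (ML f y) ⟩
    - (ML f y - ML f x)                      ≡⟨ cong -_ (ML-change f x y i (xp-flip-elsewhere p A i)) ⟩
    - ((y i - x i) * ∂ i f x)                ≡⟨ cong (λ t → - (t * ∂ i f x)) (xp-flip p A i) ⟩
    - (- ((p + p - 1ℚ) * sgn A i) * ∂ i f x) ≡⟨ solve 3 (λ q s d → :- ((:- (q :* s)) :* d) := q :* (s :* d)) refl
                                                       (p + p - 1ℚ) (sgn A i) (∂ i f x) ⟩
    (p + p - 1ℚ) * (sgn A i * ∂ i f x)       ∎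

-- Against a derivative d of sign sgn_A(i), the direction 1_C - x_p(A) is
-- dominated by (1-p) sgn_A coordinatewise.
direction-dominated : ∀ p a c d → 0ℚ ≤ signOf a * d →
  0ℚ ≤ (1ℚ - p) * (signOf a * d) - ((if c then 1ℚ else 0ℚ) - (if a then p else 1ℚ - p)) * d
direction-dominated p true true d _ =
  subst (0ℚ ≤_) (sym (solve 2 (λ p d → (con 1ℚ :- p) :* (con 1ℚ :* d) :- (con 1ℚ :- p) :* d := con 0ℚ) refl p d))
        ℚP.≤-refl
direction-dominated p true false d h =
  subst (0ℚ ≤_) (solve 2 (λ p d → con 1ℚ :* d := (con 1ℚ :- p) :* (con 1ℚ :* d) :- (con 0ℚ :- p) :* d) refl p d) h
direction-dominated p false true d h =
  subst (0ℚ ≤_) (solve 2 (λ p d → (:- con 1ℚ) :* d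
                                 := (con 1ℚ :- p) :* ((:- con 1ℚ) :* d) :- (con 1ℚ :- (con 1ℚ :- p)) :* d) refl p d) h
direction-dominated p false false d _ =
  subst (0ℚ ≤_) (sym (solve 2 (λ p d → (con 1ℚ :- p) :* ((:- con 1ℚ) :* d) :- (con 0ℚ :- (con 1ℚ :- p)) :* d
                                      := con 0ℚ) refl p d)) ℚP.≤-refl

-- The arithmetic behind the key inequality, for G = ⟨sgn_A, ∇ML f x⟩,
-- Σ = ⟨1_C - x, ∇ML f x⟩, Φ = ML f x, U = ML f(x ∨ 1_C), I = ML f(x ∧ 1_C)
-- and t = f(X ∪ C), c = f C, a = f(A ∪ C), m = f(A ∩ C), b = f(∅ ∩ C), k = f(X ∖ A).
key-arithmetic : ∀ p G Σ Φ U I t c a m b k → 0ℚ ≤ 1ℚ - p → 0ℚ ≤ p + p - 1ℚ →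
  0ℚ ≤ (1ℚ - p) * G - Σ → 0ℚ ≤ Σ - (U + I - (Φ + Φ)) →
  0ℚ ≤ U - ((1ℚ - p) * t + (p + p - 1ℚ) * a + (1ℚ - p) * c) →
  0ℚ ≤ I - ((1ℚ - p) * c + (p + p - 1ℚ) * m + (1ℚ - p) * b) →
  0ℚ ≤ t → 0ℚ ≤ b → 0ℚ ≤ a + m + k - c →
  0ℚ ≤ (1ℚ - p) * G - (c - (Φ + Φ) - (p + p - 1ℚ) * k)
key-arithmetic p G Σ Φ U I t c a m b k 1-p≥0 2p-1≥0 dominated concave U-bound I-bound t≥0 b≥0 complement =
  subst (0ℚ ≤_)
    (solve 12 (λ p G Σ Φ U I t c a m b k →
        (con 1ℚ :- p) :* G :- Σ :+ (Σ :- (U :+ I :- (Φ :+ Φ)))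
        :+ (U :- ((con 1ℚ :- p) :* t :+ (p :+ p :- con 1ℚ) :* a :+ (con 1ℚ :- p) :* c))
        :+ (I :- ((con 1ℚ :- p) :* c :+ (p :+ p :- con 1ℚ) :* m :+ (con 1ℚ :- p) :* b))
        :+ (con 1ℚ :- p) :* t :+ (con 1ℚ :- p) :* b
        :+ (p :+ p :- con 1ℚ) :* (a :+ m :+ k :- c)
        := (con 1ℚ :- p) :* G :- (c :- (Φ :+ Φ) :- (p :+ p :- con 1ℚ) :* k)) refl
      p G Σ Φ U I t c a m b k)
    (0≤+ (0≤+ (0≤+ (0≤+ (0≤+ (0≤+ dominated concave) U-bound) I-bound) (0≤* 1-p≥0 t≥0)) (0≤* 1-p≥0 b≥0))
         (0≤* 2p-1≥0 complement))

key-inequality : (f : Subset n → ℚ) → Nonnegative f → Submodular f → (C : Subset n) →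
  ∀ {p} → 0ℚ < p + p - 1ℚ → 0ℚ ≤ 1ℚ - p → (A : Subset n) →
  (∀ i → ML f (xp p (flipAt A i)) ≤ ML f (xp p A)) →
  0ℚ ≤ (1ℚ - p) * deriv (sgn A) f (xp p A) - (f C - (ML f (xp p A) + ML f (xp p A)) - (p + p - 1ℚ) * f (∁ A))
key-inequality f f≥0 sub C {p} 2p-1>0 1-p≥0 A lo =
  key-arithmetic p G Σ (ML f x) U I (f (⊤ ∪ C)) (f C) (f (A ∪ C)) (f (A ∩ C)) (f (⊥ ∩ C)) (f (∁ A))
    1-p≥0 2p-1≥0 dominated (concavity f sub bx C) U-bound I-bound (f≥0 (⊤ ∪ C)) (f≥0 (⊥ ∩ C))
    (complement-bound f≥0 sub A C)
  where
  x = xp p A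
  2p-1≥0 = ℚP.<⇒≤ 2p-1>0
  bx = xp-box (upper-half {p} 2p-1≥0 1-p≥0) A
  G = deriv (sgn A) f x
  Σ = deriv (λ i → 𝟙 C i - x i) f x
  U = ML (λ S → f (S ∪ C)) x
  I = ML (λ S → f (S ∩ C)) x
  dominated : 0ℚ ≤ (1ℚ - p) * G - Σ
  dominated = subst (0ℚ ≤_) (sum-scale-sub (1ℚ - p) (λ i → sgn A i * ∂ i f x) (λ i → (𝟙 C i - x i) * ∂ i f x))
    (sum-nonneg (λ i → direction-dominated p (lookup A i) (lookup C i) (∂ i f x) (local-opt-sign f 2p-1>0 A lo i)))
  -- the lower bound at x_p(A) for f(· ∪ C) and f(· ∩ C), where ∅ ∪ C = X ∩ C = C
  U-bound : 0ℚ ≤ U - ((1ℚ - p) * f (⊤ ∪ C) + (p + p - 1ℚ) * f (A ∪ C) + (1ℚ - p) * f C)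
  U-bound = subst (λ Y → 0ℚ ≤ U - ((1ℚ - p) * f (⊤ ∪ C) + (p + p - 1ℚ) * f (A ∪ C) + (1ℚ - p) * f Y))
                  (∪-identityˡ C) (xp-lower-bound (λ S → f (S ∪ C)) (Submodular-∪ {f = f} sub C) {p} 2p-1≥0 1-p≥0 A)
  I-bound : 0ℚ ≤ I - ((1ℚ - p) * f C + (p + p - 1ℚ) * f (A ∩ C) + (1ℚ - p) * f (⊥ ∩ C))
  I-bound = subst (λ Y → 0ℚ ≤ I - ((1ℚ - p) * f Y + (p + p - 1ℚ) * f (A ∩ C) + (1ℚ - p) * f (⊥ ∩ C)))
                  (∩-identityˡ C) (xp-lower-bound (λ S → f (S ∩ C)) (Submodular-∩ {f = f} sub C) {p} 2p-1≥0 1-p≥0 A)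

maximiser-bound : {f : Subset n → ℚ} → Nonnegative f → (C : Subset n) → (∀ S → f S ≤ f C) →
  ∀ S → Bounded (f C) (f S)
maximiser-bound f≥0 C max S = bounds (≤⇒0≤- (max S)) (0≤+ (f≥0 C) (f≥0 S))

shift-expansion : (f : Subset n → ℚ) {M : ℚ} → (∀ S → Bounded M (f S)) → ∀ {p t δ} →
  InUnit p → InUnit (p + t) → Bounded δ t → (A : Subset n) →
  Bounded (K n * (δ * δ) * M) (ML f (xp (p + t) A) - ML f (xp p A) - t * deriv (sgn A) f (xp p A))
shift-expansion {n} f {M} hM {p} {t} {δ} p∈I p+t∈I t≤δ A =
  subst (λ L → Bounded (K n * (δ * δ) * M) (ML f (xp (p + t) A) - ML f (xp p A) - L)) along
        (taylor f (xp-box p∈I A) (xp-box p+t∈I A) close hM)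
  where
  close : ∀ i → Bounded δ (xp (p + t) A i - xp p A i)
  close i = subst (Bounded δ) (sym (xp-shift p t A i)) (Bounded-sign (lookup A i) t≤δ)
  along : deriv (λ i → xp (p + t) A i - xp p A i) f (xp p A) ≡ t * deriv (sgn A) f (xp p A)
  along = trans (sum-cong-≗ (λ i → trans (cong (_* ∂ i f (xp p A)) (xp-shift p t A i))
                                         (ℚP.*-assoc t (sgn A i) (∂ i f (xp p A)))))
                (sym (*-distribˡ-sum t (λ i → sgn A i * ∂ i f (xp p A))))

search-increases : {f : Subset n → ℚ} {q : ℚ} {A B : Subset n} → Star (Improves f q) A B →
  F f (xp q A) ≤ F f (xp q B)
search-increases ε = ℚP.≤-refl
search-increases {f = f} {q} ((_ , _ , improves) ◅ rest) =
  ℚP.≤-trans (ℚP.<⇒≤ improves) (search-increases {f = f} {q} rest)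

LocalOpt⇒ML : {f : Subset n → ℚ} {p : ℚ} {A : Subset n} → LocalOpt f p A →
  ∀ i → ML f (xp p (flipAt A i)) ≤ ML f (xp p A)
LocalOpt⇒ML {f = f} {p} {A} lo i = subst₂ _≤_ (F≡ML f (xp p (flipAt A i))) (F≡ML f (xp p A)) (lo i)

-- At the centre w of the cube,  (4 - n - n²) f C ≤ 4 ML f w  for nonnegative f:
-- for n = 0 both sides are 4 f C, for n = 1 ML f w is the average of the two
-- values of f, and for n ≥ 2 the left-hand side is ≤ 0.
centre-bound : (f : Subset n → ℚ) → Nonnegative f → (C : Subset n) {w : Fin n → ℚ} → (∀ i → w i ≡ ½) →
  0ℚ ≤ (fromℕ n * fromℕ n + fromℕ n - + 4 / 1) * f C + (+ 4 / 1) * ML f w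
centre-bound {zero} f f≥0 [] _ =
  subst (0ℚ ≤_) (sym (solve 1 (λ a → (con 0ℚ :* con 0ℚ :+ con 0ℚ :- con (+ 4 / 1)) :* a :+ con (+ 4 / 1) :* a
                               := con 0ℚ) refl (f [])))
        ℚP.≤-refl
centre-bound {suc zero} f f≥0 (c ∷ []) {w} w≡½ =
  subst (λ u → 0ℚ ≤ (1ℚ * 1ℚ + 1ℚ - + 4 / 1) * f (c ∷ []) + (+ 4 / 1) * mix u a b) (sym (w≡½ zero)) (at-vertex c)
  where
  a = f (false ∷ [])
  b = f (true ∷ [])
  at-vertex : ∀ c → 0ℚ ≤ (1ℚ * 1ℚ + 1ℚ - + 4 / 1) * f (c ∷ []) + (+ 4 / 1) * mix ½ a b
  at-vertex true  = subst (0ℚ ≤_) (solve 2 (λ a b → con (+ 2 / 1) :* a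
                       := (con 1ℚ :* con 1ℚ :+ con 1ℚ :- con (+ 4 / 1)) :* b :+ con (+ 4 / 1) :* :mix (con ½) a b)
                     refl a b) (0≤* (fromℕ-nonneg 2) (f≥0 _))
  at-vertex false = subst (0ℚ ≤_) (solve 2 (λ a b → con (+ 2 / 1) :* b
                       := (con 1ℚ :* con 1ℚ :+ con 1ℚ :- con (+ 4 / 1)) :* a :+ con (+ 4 / 1) :* :mix (con ½) a b)
                     refl a b) (0≤* (fromℕ-nonneg 2) (f≥0 _))
centre-bound {suc (suc m)} f f≥0 C {w} w≡½ =
  subst (0ℚ ≤_) (sym expand) (0≤+ (0≤* coefficient≥0 (f≥0 C)) (0≤* (fromℕ-nonneg 4) (ML-nonneg centre∈box f≥0)))
  where
  k = fromℕ m
  size : fromℕ (suc (suc m)) ≡ k + 1ℚ + 1ℚ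
  size = trans (fromℕ-suc (suc m)) (cong (_+ 1ℚ) (fromℕ-suc m))
  expand : (fromℕ (suc (suc m)) * fromℕ (suc (suc m)) + fromℕ (suc (suc m)) - + 4 / 1) * f C + (+ 4 / 1) * ML f w
         ≡ (k * k + (+ 5 / 1) * k + (+ 2 / 1)) * f C + (+ 4 / 1) * ML f w
  expand = trans (cong (λ l → (l * l + l - + 4 / 1) * f C + (+ 4 / 1) * ML f w) size)
    (solve 3 (λ k a e → ((k :+ con 1ℚ :+ con 1ℚ) :* (k :+ con 1ℚ :+ con 1ℚ) :+ (k :+ con 1ℚ :+ con 1ℚ)
                          :- con (+ 4 / 1)) :* a :+ con (+ 4 / 1) :* e
                        := (k :* k :+ con (+ 5 / 1) :* k :+ con (+ 2 / 1)) :* a :+ con (+ 4 / 1) :* e) refl k (f C) (ML f w))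
  coefficient≥0 : 0ℚ ≤ k * k + (+ 5 / 1) * k + (+ 2 / 1)
  coefficient≥0 = 0≤+ (0≤+ (0≤* (fromℕ-nonneg m) (fromℕ-nonneg m)) (0≤* (fromℕ-nonneg 5) (fromℕ-nonneg m)))
                      (fromℕ-nonneg 2)
  centre∈box : Box w
  centre∈box i = subst InUnit (sym (w≡½ i)) (unit 0≤½ 0≤½)

-- One phase of the algorithm.

gain-bound : ℕ → (δ β O Φ p : ℚ) → ℚ
gain-bound n δ β O Φ p =
  δ * (((1ℚ - ((+ 2 / 1) * δ * fromℕ n * fromℕ n)) * O) - ((+ 2 / 1) * Φ) - ((((+ 2 / 1) * p) - 1ℚ) * β))

-- With Φx, Φy, Φz the values of ML f at
-- x = x_p(A), y = x_{p+δ}(A), z = x_{p+δ}(B), G = ⟨sgn_A, ∇ML f x⟩, O = f C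
-- and a = f(X ∖ A), the claimed bound is a nonnegative combination of the
-- local search, Taylor, key and β estimates.
above-half-arithmetic : ∀ n p δ O β Φx Φy Φz G a → 0ℚ ≤ δ → InUnit p → 0ℚ ≤ p + p - 1ℚ → 0ℚ ≤ O →
  0ℚ ≤ Φz - Φy → 0ℚ ≤ K n * (δ * δ) * O + (Φy - Φx - δ * G) →
  0ℚ ≤ (1ℚ - p) * G - (O - (Φx + Φx) - (p + p - 1ℚ) * a) → a ≤ β →
  gain-bound n δ β O Φx p ≤ (1ℚ - p) * (Φz - Φx)
above-half-arithmetic n p δ O β Φx Φy Φz G a δ≥0 (unit p≥0 1-p≥0) 2p-1≥0 O≥0 searched expansion key a≤β =
  0≤-⇒≤ (subst (0ℚ ≤_) certificate
    (0≤+ (0≤+ (0≤+ (0≤+ (0≤* 1-p≥0 searched) (0≤* 1-p≥0 expansion)) (0≤* δ≥0 key))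
              (0≤* δ≥0 (0≤* 2p-1≥0 (≤⇒0≤- a≤β))))
         (0≤* (0≤* (0≤* δ≥0 δ≥0) O≥0) (0≤+ (0≤+ (fromℕ-nonneg n) (fromℕ-nonneg n)) (0≤* p≥0 (K-nonneg n))))))
  where
  certificate : (1ℚ - p) * (Φz - Φy) + (1ℚ - p) * (K n * (δ * δ) * O + (Φy - Φx - δ * G))
                + δ * ((1ℚ - p) * G - (O - (Φx + Φx) - (p + p - 1ℚ) * a))
                + δ * ((p + p - 1ℚ) * (β - a))
                + δ * δ * O * ((fromℕ n + fromℕ n) + p * K n)
              ≡ (1ℚ - p) * (Φz - Φx) - gain-bound n δ β O Φx p
  certificate = solve 10 (λ p d O b ex ey ez g a m →
      (con 1ℚ :- p) :* (ez :- ey) :+ (con 1ℚ :- p) :* (:K m :* (d :* d) :* O :+ (ey :- ex :- d :* g))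
      :+ d :* ((con 1ℚ :- p) :* g :- (O :- (ex :+ ex) :- (p :+ p :- con 1ℚ) :* a))
      :+ d :* ((p :+ p :- con 1ℚ) :* (b :- a))
      :+ d :* d :* O :* ((m :+ m) :+ p :* :K m)
      := (con 1ℚ :- p) :* (ez :- ex)
         :- d :* (((con 1ℚ :- (con (+ 2 / 1) :* d :* m :* m)) :* O) :- (con (+ 2 / 1) :* ex)
                  :- (((con (+ 2 / 1) :* p) :- con 1ℚ) :* b))) refl
    p δ O β Φx Φy Φz G a (fromℕ n)

step-above-half : (f : Subset n → ℚ) → Nonnegative f → Submodular f → (C : Subset n) → (∀ S → f S ≤ f C) →
  ∀ {δ β p q} → 0ℚ < δ → q ≡ p + δ → 0ℚ < p + p - 1ℚ → q < 1ℚ → (A B : Subset n) →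
  LocalOpt f p A → Star (Improves f q) A B → f (∁ A) ≤ β →
  gain-bound n δ β (f C) (ML f (xp p A)) p ≤ (1ℚ - p) * (ML f (xp q B) - ML f (xp p A))
step-above-half {n} f f≥0 sub C max {δ} {β} {p} δ>0 refl 2p-1>0 q<1 A B lo search β-bound =
  above-half-arithmetic n p δ (f C) β (ML f x) (ML f y) (ML f z) (deriv (sgn A) f x) (f (∁ A))
    δ≥0 p∈I 2p-1≥0 (f≥0 C) searched expansion key β-bound
  where
  q = p + δ
  x = xp p A
  y = xp q A
  z = xp q B
  δ≥0 = ℚP.<⇒≤ δ>0
  2p-1≥0 = ℚP.<⇒≤ 2p-1>0
  1-q≥0 = ℚP.<⇒≤ (<⇒0<- q<1)
  1-p≥0 : 0ℚ ≤ 1ℚ - p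
  1-p≥0 = subst (0ℚ ≤_) (solve 2 (λ p d → (con 1ℚ :- (p :+ d)) :+ d := con 1ℚ :- p) refl p δ) (0≤+ 1-q≥0 δ≥0)
  p∈I = upper-half {p} 2p-1≥0 1-p≥0
  δ-bounded : Bounded δ δ
  δ-bounded = bounds (subst (0ℚ ≤_) (sym (ℚP.+-inverseʳ δ)) ℚP.≤-refl) (0≤+ δ≥0 δ≥0)
  searched : 0ℚ ≤ ML f z - ML f y
  searched = ≤⇒0≤- (subst₂ _≤_ (F≡ML f y) (F≡ML f z) (search-increases {f = f} {q} search))
  expansion : 0ℚ ≤ K n * (δ * δ) * f C + (ML f y - ML f x - δ * deriv (sgn A) f x)
  expansion = Bounded.lower (shift-expansion f (maximiser-bound f≥0 C max)
                                             p∈I (unit (0≤+ (InUnit.≥0 p∈I) δ≥0) 1-q≥0) δ-bounded A)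
  key = key-inequality f f≥0 sub C 2p-1>0 1-p≥0 A (LocalOpt⇒ML {f = f} {p} {A} lo)

-- With Φw, Φz the
-- values of ML f at the centre w and at z = x_q(B), G = ⟨sgn_B, ∇ML f z⟩,
-- O = f C and a = f(X ∖ B), the claimed bound times q is a nonnegative
-- combination of the Taylor, key and centre estimates and of a ≤ O.
at-half-arithmetic : ∀ n δ O β Φw Φz G a → 0ℚ < δ → 0ℚ ≤ 1ℚ - (½ + δ) → 0ℚ ≤ O →
  0ℚ ≤ K n * (δ * δ) * O - (Φw - Φz - (- δ) * G) →
  0ℚ ≤ (1ℚ - (½ + δ)) * G - (O - (Φz + Φz) - ((½ + δ) + (½ + δ) - 1ℚ) * a) → a ≤ O →
  0ℚ ≤ (fromℕ n * fromℕ n + fromℕ n - + 4 / 1) * O + (+ 4 / 1) * Φw →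
  gain-bound n δ β O Φw ½ ≤ (1ℚ - ½) * (Φz - Φw)
at-half-arithmetic n δ O β Φw Φz G a δ>0 1-q≥0 O≥0 expansion key a≤O centre =
  0≤-⇒≤ (0≤-cancelˡ (0≤+0< 0≤½ δ>0) (subst (0ℚ ≤_) certificate
    (0≤+ (0≤+ (0≤+ (0≤* (0≤* 0≤½ 1-q≥0) expansion) (0≤* (0≤* 0≤½ δ≥0) key))
              (0≤* (0≤* δ≥0 δ≥0) (≤⇒0≤- a≤O)))
         (0≤* (0≤* δ≥0 δ≥0)
              (0≤+ (0≤* 0≤½ centre)
                   (0≤* (0≤* δ≥0 O≥0) (0≤+ (0≤+ n²≥0 n²≥0) (0≤* 0≤½ (K-nonneg n)))))))))
  where
  δ≥0 = ℚP.<⇒≤ δ>0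
  n²≥0 = 0≤* (fromℕ-nonneg n) (fromℕ-nonneg n)
  certificate : ½ * (1ℚ - (½ + δ)) * (K n * (δ * δ) * O - (Φw - Φz - (- δ) * G))
                + ½ * δ * ((1ℚ - (½ + δ)) * G - (O - (Φz + Φz) - ((½ + δ) + (½ + δ) - 1ℚ) * a))
                + δ * δ * (O - a)
                + δ * δ * (½ * ((fromℕ n * fromℕ n + fromℕ n - + 4 / 1) * O + (+ 4 / 1) * Φw)
                           + δ * O * (fromℕ n * fromℕ n + fromℕ n * fromℕ n + ½ * K n))
              ≡ (½ + δ) * ((1ℚ - ½) * (Φz - Φw) - gain-bound n δ β O Φw ½)
  certificate = solve 8 (λ d O b ew ez g a m →
      con ½ :* (con 1ℚ :- (con ½ :+ d)) :* (:K m :* (d :* d) :* O :- (ew :- ez :- (:- d) :* g))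
      :+ con ½ :* d :* ((con 1ℚ :- (con ½ :+ d)) :* g
                        :- (O :- (ez :+ ez) :- ((con ½ :+ d) :+ (con ½ :+ d) :- con 1ℚ) :* a))
      :+ d :* d :* (O :- a)
      :+ d :* d :* (con ½ :* ((m :* m :+ m :- con (+ 4 / 1)) :* O :+ con (+ 4 / 1) :* ew)
                    :+ d :* O :* (m :* m :+ m :* m :+ con ½ :* :K m))
      := (con ½ :+ d) :* ((con 1ℚ :- con ½) :* (ez :- ew)
           :- d :* (((con 1ℚ :- (con (+ 2 / 1) :* d :* m :* m)) :* O) :- (con (+ 2 / 1) :* ew)
                    :- (((con (+ 2 / 1) :* con ½) :- con 1ℚ) :* b)))) refl
    δ O β Φw Φz G a (fromℕ n)

-- The first phase p = ½ (where x_½(A) is the centre of the cube whatever A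
-- is), followed by the phase q = ½ + δ ending in B.
step-at-half : (f : Subset n → ℚ) → Nonnegative f → Submodular f → (C : Subset n) → (∀ S → f S ≤ f C) →
  ∀ {δ β p q} → 0ℚ < δ → p ≡ ½ → q ≡ ½ + δ → q < 1ℚ → (A B : Subset n) → LocalOpt f q B →
  gain-bound n δ β (f C) (ML f (xp p A)) p ≤ (1ℚ - p) * (ML f (xp q B) - ML f (xp p A))
step-at-half {n} f f≥0 sub C max {δ} {β} δ>0 refl refl q<1 A B lo =
  at-half-arithmetic n δ (f C) β (ML f w) (ML f z) G (f (∁ B)) δ>0 1-q≥0 (f≥0 C)
    expansion key (max (∁ B)) (centre-bound f f≥0 C (xp-centre refl A))
  where
  q = ½ + δ
  w = xp ½ A
  z = xp q B
  G = deriv (sgn B) f z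
  δ≥0 = ℚP.<⇒≤ δ>0
  1-q≥0 = ℚP.<⇒≤ (<⇒0<- q<1)
  2q-1>0 : 0ℚ < q + q - 1ℚ
  2q-1>0 = subst (0ℚ <_) (solve 1 (λ d → d :+ d := (con ½ :+ d) :+ (con ½ :+ d) :- con 1ℚ) refl δ) (0≤+0< δ≥0 δ>0)
  back-to-centre : q + - δ ≡ ½
  back-to-centre = solve 1 (λ d → (con ½ :+ d) :+ (:- d) := con ½) refl δ
  -δ-bounded : Bounded δ (- δ)
  -δ-bounded = bounds (subst (0ℚ ≤_) (solve 1 (λ d → d :+ d := d :- (:- d)) refl δ) (0≤+ δ≥0 δ≥0))
                      (subst (0ℚ ≤_) (sym (ℚP.+-inverseʳ δ)) ℚP.≤-refl)
  expansion : 0ℚ ≤ K n * (δ * δ) * f C - (ML f w - ML f z - (- δ) * G)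
  expansion = subst (λ e → 0ℚ ≤ K n * (δ * δ) * f C - (e - ML f z - (- δ) * G))
    (ML-cong f (λ i → trans (xp-centre back-to-centre B i) (sym (xp-centre refl A i))))
    (Bounded.upper (shift-expansion f (maximiser-bound f≥0 C max) (unit (0≤+ 0≤½ δ≥0) 1-q≥0)
                                    (subst InUnit (sym back-to-centre) (unit 0≤½ 0≤½)) -δ-bounded B))
  key = key-inequality f f≥0 sub C 2q-1>0 1-q≥0 B (LocalOpt⇒ML {f = f} {q} {B} lo)

param-zero : ∀ δ → param δ 0 ≡ ½
param-zero δ = solve 1 (λ d → con ½ :+ con 0ℚ :* d := con ½) refl δ

param-suc : ∀ δ j → param δ (suc j) ≡ param δ j + δ
param-suc δ j = trans (cong (λ k → ½ + k * δ) (fromℕ-suc j))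
  (solve 2 (λ k d → con ½ :+ (k :+ con 1ℚ) :* d := (con ½ :+ k :* d) :+ d) refl (fromℕ j) δ)

param-above-half : ∀ {δ} → 0ℚ < δ → ∀ m → 0ℚ < param δ (suc m) + param δ (suc m) - 1ℚ
param-above-half {δ} δ>0 m = subst (0ℚ <_) twice (0≤+0< (0≤+ mδ≥0 mδ≥0) (0≤+0< (ℚP.<⇒≤ δ>0) δ>0))
  where
  mδ≥0 = 0≤* (fromℕ-nonneg m) (ℚP.<⇒≤ δ>0)
  twice : (fromℕ m * δ + fromℕ m * δ) + (δ + δ) ≡ param δ (suc m) + param δ (suc m) - 1ℚ
  twice = trans (solve 2 (λ k d → (k :* d :+ k :* d) :+ (d :+ d)
                              := (con ½ :+ (k :+ con 1ℚ) :* d) :+ (con ½ :+ (k :+ con 1ℚ) :* d) :- con 1ℚ) refl (fromℕ m) δ)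
                (cong (λ k → (½ + k * δ) + (½ + k * δ) - 1ℚ) (sym (fromℕ-suc m)))

param-increasing : ∀ {δ} → 0ℚ < δ → ∀ j → param δ j < param δ (suc j)
param-increasing {δ} δ>0 j =
  0<-⇒< (subst (0ℚ <_) (sym (trans (cong (_- param δ j) (param-suc δ j))
                                    (solve 2 (λ p d → (p :+ d) :- p := d) refl (param δ j) δ))) δ>0)

lemma3p4 : ∀ {n : ℕ} (f : Subset n → ℚ) (δ β OPT : ℚ) (A : ℕ → Subset n) →
    0ℚ < δ → Nonnegative f → Submodular f → IsMax f OPT →
    IsRun f δ A →
    (∀ j → param δ j < 1ℚ → f (∁ (A j)) ≤ β) →
    ∀ j → param δ (suc j) < 1ℚ →
    δ * (((1ℚ - ((+ 2 / 1) * δ * (+ n / 1) * (+ n / 1))) * OPT)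
          - ((+ 2 / 1) * F f (xp (param δ j) (A j)))
          - ((((+ 2 / 1) * param δ j) - 1ℚ) * β))
      ≤ (1ℚ - param δ j) * (F f (xp (param δ (suc j)) (A (suc j))) - F f (xp (param δ j) (A j)))
lemma3p4 {n} f δ β _ A δ>0 f≥0 sub ((C , refl) , max) run β-bound j q<1
  rewrite F≡ML f (xp (param δ j) (A j)) | F≡ML f (xp (param δ (suc j)) (A (suc j))) = phase j q<1
  where
  phase : ∀ j → param δ (suc j) < 1ℚ →
    gain-bound n δ β (f C) (ML f (xp (param δ j) (A j))) (param δ j)
      ≤ (1ℚ - param δ j) * (ML f (xp (param δ (suc j)) (A (suc j))) - ML f (xp (param δ j) (A j)))
  phase zero q<1 =
    step-at-half f f≥0 sub C max δ>0 (param-zero δ) (trans (param-suc δ 0) (cong (_+ δ) (param-zero δ))) q<1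
                 (A 0) (A 1) (proj₂ (run 1 q<1))
  phase (suc m) q<1 =
    step-above-half f f≥0 sub C max δ>0 (param-suc δ (suc m)) (param-above-half δ>0 m) q<1
                    (A (suc m)) (A (suc (suc m)))
                    (proj₂ (run (suc m) p<1)) (proj₁ (run (suc (suc m)) q<1)) (β-bound (suc m) p<1)
    where
    p<1 : param δ (suc m) < 1ℚ
    p<1 = ℚP.<-trans (param-increasing δ>0 (suc m)) q<1
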